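{- Let $G=(V,E)$ be a graph satisfying the standing assumptions. Let $u\in V$ and let $(u_i)_{i\ge1}$ be an occurrence of $\min_u$ starting at $u$. Then exactly one of the following holds: (1) there exists $i_0\ge1$ such that $\tau(u_i)\neq2$ for every $1\le i<i_0$ and $\tau(u_i)=2$ for every $i\ge i_0$; (2) $\tau(u_i)\neq2$ for every $i\ge1$, and both $\tau(u_i)=1$ and $\tau(u_i)=3$ hold for infinitely many $i$.
   Context: Standing assumptions: $\Sigma$ is a finite alphabet with a total order $\preceq$; $G=(V,E)$ is finite, $E\subseteq V\times V\times\Sigma$, every node has an incoming edge, all edges entering a node $u$ have the same label $\lambda(u)$ (edges are written $(u,v)$), and $G$ is deterministic. An occurrence of $\alpha\in\Sigma^\omega$ starting at $u$ is a sequence $(u_i)_{i\ge1}$ with $u_1=u$, $(u_{i+1},u_i)\in E$, $\lambda(u_i)=\alpha[i]$; $\min_u$ is the lexicographically smallest string in $\Sigma^\omega$ with an occurrence starting at $u$. For $\alpha=a\alpha'$ ($a\in\Sigma$): $\tau(\alpha)=1$ if $\alpha'\prec\alpha$, $2$ if $\alpha'=\alpha$, $3$ if $\alpha\prec\alpha'$; $\tau(u):=\tau(\min_u)$. -}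

module Defs where

open import Data.Nat using (ℕ; zero; suc; _<_; _≤_)
open import Data.Fin using (Fin) renaming (_<_ to _<ᶠ_)
open import Data.Bool using (Bool; T)
open import Data.Product using (Σ; ∃; _×_; _,_)
open import Data.Sum using (_⊎_)
open import Relation.Binary.PropositionalEquality using (_≡_)
open import Relation.Nullary using (¬_)

-- The alphabet Σ is Fin σ, totally ordered by the usual order on Fin
-- (every finite totally ordered set is order-isomorphic to some Fin σ).

-- Infinite strings over Fin σ, indexed from 0 (α[1] of the paper is α 0).
Str : ℕ → Set
Str σ = ℕ → Fin σ

_≈ₛ_ : ∀ {σ} → Str σ → Str σ → Set
α ≈ₛ β = ∀ i → α i ≡ β i

_≺_ : ∀ {σ} → Str σ → Str σ → Set
α ≺ β = ∃ λ k → (∀ j → j < k → α j ≡ β j) × (α k <ᶠ β k)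

_⪯_ : ∀ {σ} → Str σ → Str σ → Set
α ⪯ β = α ≺ β ⊎ α ≈ₛ β

tail : ∀ {σ} → Str σ → Str σ
tail α i = α (suc i)

τ≡1 τ≡2 τ≡3 : ∀ {σ} → Str σ → Set
τ≡1 α = tail α ≺ α
τ≡2 α = tail α ≈ₛ α
τ≡3 α = α ≺ tail α

-- A finite edge-labeled graph with node set Fin n over alphabet Fin σ.
-- edge u v a = true  means  (u, v, a) ∈ E.  λ is the label of incoming edges.
record Graph (n σ : ℕ) : Set where
  field
    edge   : Fin n → Fin n → Fin σ → Bool
    lab    : Fin n → Fin σ
    lab-ok : ∀ u v a → T (edge u v a) → a ≡ lab v
    has-in : ∀ v → ∃ λ u → T (edge u v (lab v))
    det    : ∀ u v w a → T (edge u v a) → T (edge u w a) → v ≡ w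

  Edge : Fin n → Fin n → Set
  Edge u v = T (edge u v (lab v))

  -- s is an occurrence of α starting at u  (s 0 = u_1 of the paper)
  Occurrence : Str σ → Fin n → (ℕ → Fin n) → Set
  Occurrence α u s = (s 0 ≡ u) × (∀ i → Edge (s (suc i)) (s i)) × (∀ i → lab (s i) ≡ α i)

  HasOcc : Str σ → Fin n → Set
  HasOcc α u = ∃ λ s → Occurrence α u s

  IsMin : Fin n → Str σ → Set
  IsMin u α = HasOcc α u × (∀ β → HasOcc β u → α ⪯ β)

{-# OPTIONS --safe #-}
module Submission where

-- Every suffix of a minimum along its occurrence is again a minimum, so min_{u_i} is the
-- suffix of α = min_u from i.  By pigeonhole the occurrence revisits a node, and minima are
-- unique, so α is eventually periodic.  If its periodic part is constant, τ = 2 exactly from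
-- the least index from which α is constant.  Otherwise no suffix is constant, each suffix in
-- the periodic part is strictly comparable with its tail (periodic strings are compared on
-- one period), and every period contains both cases: a whole period of suffixes with τ = 3
-- would give β ≺ drop P β ≈ β, and dually for τ = 1.

open import Defs
open import Data.Nat using (ℕ; zero; suc; _<_; _≤_; _+_; _*_; _∸_; z≤n; s≤s)
open import Data.Nat.Properties
  using (<-cmp; <-trans; ≤-refl; ≤-trans; m≤m+n; n<1+n; m<n⇒m<1+n; m<1+n⇒m<n∨m≡n;
         m<1+n⇒m≤n; m≤n+m; +-comm; +-suc; *-suc; m+[n∸m]≡n)
open import Data.Nat.DivMod using (_/_; _%_; m≡m%n+[m/n]*n; m%n<n)
open import Data.Fin using (Fin; toℕ; _≟_) renaming (_<_ to _<ᶠ_)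
import Data.Fin.Properties as Fin
open import Data.Product using (∃; ∃₂; _×_; _,_; proj₁)
open import Data.Sum using (_⊎_; inj₁; inj₂; [_,_]; swap; map)
open import Data.Empty using (⊥-elim)
open import Function using (_∘_; flip)
open import Relation.Nullary using (¬_; yes; no)
open import Relation.Binary.Bundles using (Setoid)
open import Relation.Binary.Definitions using (Transitive; tri<; tri≈; tri>)
open import Relation.Binary.PropositionalEquality hiding ([_])

drop : {A : Set} → ℕ → (ℕ → A) → ℕ → A
drop zero    f = f
drop (suc x) f = drop x (f ∘ suc)

_◂_ : {A : Set} → A → (ℕ → A) → ℕ → A
(a ◂ f) zero    = a
(a ◂ f) (suc k) = f k

module _ {A : Set} where

  drop-suc : ∀ x (f : ℕ → A) → drop (suc x) f ≡ drop x f ∘ suc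
  drop-suc zero    f = refl
  drop-suc (suc x) f = drop-suc x (f ∘ suc)

  drop-+ : ∀ x y (f : ℕ → A) → drop (x + y) f ≡ drop y (drop x f)
  drop-+ zero    y f = refl
  drop-+ (suc x) y f = drop-+ x y (f ∘ suc)

  drop-comm : ∀ x y (f : ℕ → A) → drop x (drop y f) ≡ drop y (drop x f)
  drop-comm x y f =
    trans (sym (drop-+ y x f)) (trans (cong (λ z → drop z f) (+-comm y x)) (drop-+ x y f))

  drop-apply : ∀ x (f : ℕ → A) k → drop x f k ≡ f (x + k)
  drop-apply zero    f k = refl
  drop-apply (suc x) f k = drop-apply x (f ∘ suc) k

first-or-all : {P Q : ℕ → Set} → (∀ e → P e ⊎ Q e) → ∀ b →
  (∃ λ e → e < b × P e × (∀ e′ → e′ < e → Q e′)) ⊎ (∀ e → e < b → Q e)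
first-or-all test zero = inj₂ λ _ ()
first-or-all test (suc b) with first-or-all test b | test b
... | inj₁ (e , e<b , p , q) | _    = inj₁ (e , m<n⇒m<1+n e<b , p , q)
... | inj₂ q                 | inj₁ p = inj₁ (b , n<1+n b , p , q)
... | inj₂ q                 | inj₂ qb =
  inj₂ λ e e<1+b → [ q e , (λ { refl → qb }) ] (m<1+n⇒m<n∨m≡n e<1+b)

chain : {A : Set} {R : A → A → Set} → Transitive R → (F : ℕ → A) → ∀ q →
        (∀ e → e < suc q → R (F e) (F (suc e))) → R (F 0) (F (suc q))
chain         R-trans F zero    step = step 0 (s≤s z≤n)
chain {R = R} R-trans F (suc q) step =
  R-trans (chain {R = R} R-trans F q (λ e e<1+q → step e (m<n⇒m<1+n e<1+q))) (step (suc q) ≤-refl)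

module Strings {σ : ℕ} where

  module ≈ₛ = Setoid (ℕ →-setoid Fin σ)

  drop-resp : ∀ x {α β : Str σ} → α ≈ₛ β → drop x α ≈ₛ drop x β
  drop-resp zero    e = e
  drop-resp (suc x) e = drop-resp x (e ∘ suc)

  ≺-resp : {α α′ β β′ : Str σ} → α ≈ₛ α′ → β ≈ₛ β′ → α ≺ β → α′ ≺ β′
  ≺-resp eα eβ (k , agree , lt) =
    k , (λ j j<k → trans (sym (eα j)) (trans (agree j j<k) (eβ j))) , subst₂ _<ᶠ_ (eα k) (eβ k) lt

  ≺-irrefl : {α : Str σ} → ¬ (α ≺ α)
  ≺-irrefl (k , _ , lt) = Fin.<-irrefl refl lt

  ≺-trans : Transitive (_≺_ {σ})
  ≺-trans {α} {β} {γ} (k , a , lt) (k′ , a′ , lt′) with <-cmp k k′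
  ... | tri< k<k′ _ _ =
    k , (λ j j<k → trans (a j j<k) (a′ j (<-trans j<k k<k′))) , subst (α k <ᶠ_) (a′ k k<k′) lt
  ... | tri≈ _ refl _ = k , (λ j j<k → trans (a j j<k) (a′ j j<k)) , Fin.<-trans lt lt′
  ... | tri> _ _ k′<k =
    k′ , (λ j j<k′ → trans (a j (<-trans j<k′ k′<k)) (a′ j j<k′)) ,
    subst (_<ᶠ γ k′) (sym (a k′ k′<k)) lt′

  ⪯-antisym : {α β : Str σ} → α ⪯ β → β ⪯ α → α ≈ₛ β
  ⪯-antisym (inj₂ e)  _         = e
  ⪯-antisym (inj₁ lt) (inj₂ e)  = ⊥-elim (≺-irrefl (≺-resp ≈ₛ.refl e lt))
  ⪯-antisym (inj₁ lt) (inj₁ gt) = ⊥-elim (≺-irrefl (≺-trans lt gt))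

  ⪯-tail : {α β : Str σ} → α 0 ≡ β 0 → α ⪯ β → tail α ⪯ tail β
  ⪯-tail _   (inj₂ e)                   = inj₂ (e ∘ suc)
  ⪯-tail eq₀ (inj₁ (zero  , _ , lt))    = ⊥-elim (Fin.<-irrefl eq₀ lt)
  ⪯-tail _   (inj₁ (suc k , agree , lt)) = inj₁ (k , (λ j j<k → agree (suc j) (s≤s j<k)) , lt)

  τ≡1-resp : {α β : Str σ} → α ≈ₛ β → τ≡1 α → τ≡1 β
  τ≡1-resp e = ≺-resp (e ∘ suc) e

  τ≡2-resp : {α β : Str σ} → α ≈ₛ β → τ≡2 α → τ≡2 β
  τ≡2-resp e t k = trans (sym (e (suc k))) (trans (t k) (e k))

  τ≡3-resp : {α β : Str σ} → α ≈ₛ β → τ≡3 α → τ≡3 β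
  τ≡3-resp e = ≺-resp e (e ∘ suc)

  τ≡2-drop : ∀ x {α : Str σ} → τ≡2 α → τ≡2 (drop x α)
  τ≡2-drop zero    t = t
  τ≡2-drop (suc x) t = τ≡2-drop x (t ∘ suc)

  τ≡2-mono : ∀ {x y} (α : Str σ) → x ≤ y → τ≡2 (drop x α) → τ≡2 (drop y α)
  τ≡2-mono {x} {y} α x≤y t =
    subst τ≡2 (trans (sym (drop-+ x (y ∸ x) α)) (cong (λ z → drop z α) (m+[n∸m]≡n x≤y)))
          (τ≡2-drop (y ∸ x) t)

  τ≡2-cons : {α : Str σ} → α 1 ≡ α 0 → τ≡2 (tail α) → τ≡2 α
  τ≡2-cons eq t zero    = eq
  τ≡2-cons eq t (suc k) = t k

  Settles Oscillates : (ℕ → Str σ) → Set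
  Settles β = ∃ λ i₀ → (∀ i → i < i₀ → ¬ τ≡2 (β i)) × (∀ i → i₀ ≤ i → τ≡2 (β i))
  Oscillates β = (∀ i → ¬ τ≡2 (β i))
               × (∀ N → ∃ λ i → N ≤ i × τ≡1 (β i))
               × (∀ N → ∃ λ i → N ≤ i × τ≡3 (β i))

  Settles-resp : {β β′ : ℕ → Str σ} → (∀ i → β i ≈ₛ β′ i) → Settles β → Settles β′
  Settles-resp e (i₀ , before , after) =
    i₀ , (λ i i<i₀ → before i i<i₀ ∘ τ≡2-resp (≈ₛ.sym (e i))) ,
    (λ i i₀≤i → τ≡2-resp (e i) (after i i₀≤i))

  Oscillates-resp : {β β′ : ℕ → Str σ} → (∀ i → β i ≈ₛ β′ i) → Oscillates β → Oscillates β′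
  Oscillates-resp e (never₂ , often₁ , often₃) =
    (λ i → never₂ i ∘ τ≡2-resp (≈ₛ.sym (e i))) ,
    (λ N → let i , N≤i , t = often₁ N in i , N≤i , τ≡1-resp (e i) t) ,
    (λ N → let i , N≤i , t = often₃ N in i , N≤i , τ≡3-resp (e i) t)

  ¬Settles×Oscillates : {β : ℕ → Str σ} → ¬ (Settles β × Oscillates β)
  ¬Settles×Oscillates ((i₀ , _ , after) , never₂ , _) = never₂ i₀ (after i₀ ≤-refl)

  least-settling : ∀ c (α : Str σ) → τ≡2 (drop c α) →
                   ∃ λ i₀ → (∀ x → x < i₀ → ¬ τ≡2 (drop x α)) × τ≡2 (drop i₀ α)
  least-settling zero    α t = 0 , (λ _ ()) , t
  least-settling (suc c) α t with drop c α 1 ≟ drop c α 0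
  ... | yes eq = least-settling c α (τ≡2-cons eq (subst τ≡2 (drop-suc c α) t))
  ... | no neq = suc c , (λ x x<1+c tₓ → neq (τ≡2-mono α (m<1+n⇒m≤n x<1+c) tₓ 0)) , t

  τ≡2-drop⇒Settles : (α : Str σ) → ∀ c → τ≡2 (drop c α) → Settles (λ x → drop x α)
  τ≡2-drop⇒Settles α c t with least-settling c α t
  ... | i₀ , before , at = i₀ , before , λ x i₀≤x → τ≡2-mono α i₀≤x at

  -- A record rather than a synonym, so that the period can be inferred from a proof.
  record Periodic (P : ℕ) (α : Str σ) : Set where
    constructor periodic
    field drop-period : drop P α ≈ₛ α

  module _ {P : ℕ} {α : Str σ} (per : Periodic P α) where
    open Periodic per

    Periodic-drop : ∀ x → Periodic P (drop x α)
    Periodic-drop x = periodic λ k → trans (cong-app (drop-comm P x α) k) (drop-resp x drop-period k)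

    drop-multiple : ∀ t → drop (t * P) α ≈ₛ α
    drop-multiple zero    = ≈ₛ.refl
    drop-multiple (suc t) =
      ≈ₛ.trans (cong-app (drop-+ P (t * P) α))
               (≈ₛ.trans (drop-resp (t * P) drop-period) (drop-multiple t))

  module _ {q : ℕ} where

    periodic-agree : {α β : Str σ} → Periodic (suc q) α → Periodic (suc q) β →
                     (∀ k → k < suc q → α k ≡ β k) → α ≈ₛ β
    periodic-agree {α} {β} perα perβ agree m =
      begin
        α m                 ≡⟨ cong α m≡r+tP ⟩
        α (r + t * P)       ≡⟨ reduce perα ⟩
        α r                 ≡⟨ agree r (m%n<n m P) ⟩
        β r                 ≡⟨ reduce perβ ⟨
        β (r + t * P)       ≡⟨ cong β m≡r+tP ⟨
        β m
      ∎
      where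
      open ≡-Reasoning
      P = suc q
      r = m % P
      t = m / P
      m≡r+tP : m ≡ r + t * P
      m≡r+tP = m≡m%n+[m/n]*n m P
      reduce : {γ : Str σ} → Periodic P γ → γ (r + t * P) ≡ γ r
      reduce {γ} per = trans (cong γ (+-comm r (t * P)))
                             (trans (sym (drop-apply (t * P) γ r)) (drop-multiple per t r))

    periodic-trichotomy : {α β : Str σ} → Periodic (suc q) α → Periodic (suc q) β →
                          α ≺ β ⊎ α ≈ₛ β ⊎ β ≺ α
    periodic-trichotomy {α} {β} perα perβ with first-or-all differ? (suc q)
      where
      differ? : ∀ k → ¬ α k ≡ β k ⊎ α k ≡ β k
      differ? k with α k ≟ β k
      ... | yes eq = inj₂ eq
      ... | no neq = inj₁ neq
    ... | inj₂ agree = inj₂ (inj₁ (periodic-agree perα perβ agree))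
    ... | inj₁ (k , _ , neq , agree) with Fin.<-cmp (α k) (β k)
    ...   | tri< lt _ _ = inj₁ (k , agree , lt)
    ...   | tri≈ _ eq _ = ⊥-elim (neq eq)
    ...   | tri> _ _ gt = inj₂ (inj₂ (k , (λ j j<k → sym (agree j j<k)) , gt))

    module _ {α : Str σ} (per : Periodic (suc q) α) where
      open Periodic per

      periodic-τ≡2 : ∀ x → τ≡2 (drop x α) → τ≡2 α
      -- drop (x * P) α is both a suffix of drop x α and equal to α.
      periodic-τ≡2 x t =
        τ≡2-resp (drop-multiple per x) (subst τ≡2 (sym drop-xP) (τ≡2-drop (x * q) t))
        where
        drop-xP : drop (x * suc q) α ≡ drop (x * q) (drop x α)
        drop-xP = trans (cong (λ z → drop z α) (*-suc x q)) (drop-+ x (x * q) α)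

      periodic-τ≡2? : τ≡2 α ⊎ ¬ τ≡2 α
      periodic-τ≡2? with periodic-trichotomy (Periodic-drop per 1) per
      ... | inj₁ lt        = inj₂ λ t → ≺-irrefl (≺-resp t ≈ₛ.refl lt)
      ... | inj₂ (inj₁ eq) = inj₁ eq
      ... | inj₂ (inj₂ gt) = inj₂ λ t → ≺-irrefl (≺-resp ≈ₛ.refl t gt)

      module _ (¬τ≡2 : ¬ τ≡2 α) where

        τ≡1⊎τ≡3 : ∀ x → τ≡1 (drop x α) ⊎ τ≡3 (drop x α)
        τ≡1⊎τ≡3 x with periodic-trichotomy
                         (subst (Periodic (suc q)) (drop-suc x α) (Periodic-drop per (suc x)))
                         (Periodic-drop per x)
        ... | inj₁ lt         = inj₁ lt
        ... | inj₂ (inj₁ eq)  = ⊥-elim (¬τ≡2 (periodic-τ≡2 x eq))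
        ... | inj₂ (inj₂ gt)  = inj₂ gt

        somewhere-τ≡1 : ∃ λ x → τ≡1 (drop x α)
        somewhere-τ≡1 with first-or-all τ≡1⊎τ≡3 (suc q)
        ... | inj₁ (x , _ , t , _) = x , t
        ... | inj₂ increasing = ⊥-elim (≺-irrefl (≺-resp ≈ₛ.refl drop-period
              (chain {R = _≺_} ≺-trans (λ x → drop x α) q
                     (λ x x<P → ≺-resp ≈ₛ.refl (cong-app (sym (drop-suc x α))) (increasing x x<P)))))

        somewhere-τ≡3 : ∃ λ x → τ≡3 (drop x α)
        somewhere-τ≡3 with first-or-all (swap ∘ τ≡1⊎τ≡3) (suc q)
        ... | inj₁ (x , _ , t , _) = x , t
        ... | inj₂ decreasing = ⊥-elim (≺-irrefl (≺-resp drop-period ≈ₛ.refl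
              (chain {R = flip _≺_} (flip ≺-trans) (λ x → drop x α) q
                     (λ x x<P → ≺-resp (cong-app (sym (drop-suc x α))) ≈ₛ.refl (decreasing x x<P)))))

  eventually-periodic-dichotomy : (α : Str σ) → ∀ i q → Periodic (suc q) (drop i α) →
    Settles (λ x → drop x α) ⊎ Oscillates (λ x → drop x α)
  eventually-periodic-dichotomy α i q per with periodic-τ≡2? per
  ... | inj₁ t   = inj₁ (τ≡2-drop⇒Settles α i t)
  ... | inj₂ ¬t = inj₂ (never₂ , often τ≡1 somewhere-τ≡1 , often τ≡3 somewhere-τ≡3)
    where
    never₂ : ∀ x → ¬ τ≡2 (drop x α)
    never₂ x t = ¬t (periodic-τ≡2 per x (subst τ≡2 (drop-comm i x α) (τ≡2-drop i t)))

    window : ∀ N → Periodic (suc q) (drop (i + N) α)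
    window N = subst (Periodic (suc q)) (sym (drop-+ i N α)) (Periodic-drop per N)

    often : (T : Str σ → Set) →
            ({β : Str σ} → Periodic (suc q) β → ¬ τ≡2 β → ∃ λ x → T (drop x β)) →
            ∀ N → ∃ λ y → N ≤ y × T (drop y α)
    often T somewhere N with somewhere (window N) (never₂ (i + N))
    ... | x , t = i + N + x , ≤-trans (m≤n+m N i) (m≤m+n (i + N) x) ,
                  subst T (sym (drop-+ (i + N) x α)) t

repeats : ∀ {n} (s : ℕ → Fin n) → ∃₂ λ i q → s i ≡ s (i + suc q)
repeats {n} s with Fin.pigeonhole (n<1+n n) (s ∘ toℕ)
... | a , b , a<b , eq = toℕ a , toℕ b ∸ suc (toℕ a) ,
                         trans eq (cong s (sym (trans (+-suc (toℕ a) _) (m+[n∸m]≡n a<b))))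

module Minima {n σ : ℕ} (G : Graph n σ) where
  open Graph G
  open Strings

  Occurrence-tail : ∀ {α u s} → Occurrence α u s → Occurrence (tail α) (s 1) (s ∘ suc)
  Occurrence-tail (_ , edges , labels) = refl , edges ∘ suc , labels ∘ suc

  Occurrence-◂ : ∀ {β v w t} → Edge v w → Occurrence β v t → Occurrence (lab w ◂ β) w (w ◂ t)
  Occurrence-◂ e (refl , edges , labels) =
    refl , (λ { zero → e ; (suc k) → edges k }) , (λ { zero → refl ; (suc k) → labels k })

  IsMin-unique : ∀ {v α β} → IsMin v α → IsMin v β → α ≈ₛ β
  IsMin-unique (occα , leastα) (occβ , leastβ) = ⪯-antisym (leastα _ occβ) (leastβ _ occα)

  IsMin-tail : ∀ {v α s} → IsMin v α → Occurrence α v s → IsMin (s 1) (tail α)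
  IsMin-tail {s = s} (_ , least) occ@(refl , edges , labels) =
    (s ∘ suc , Occurrence-tail occ) ,
    λ β (t , occβ) →
      ⪯-tail (sym (labels 0)) (least (lab (s 0) ◂ β) (s 0 ◂ t , Occurrence-◂ (edges 0) occβ))

  IsMin-drop : ∀ x {u α s} → IsMin u α → Occurrence α u s → IsMin (s x) (drop x α)
  IsMin-drop zero    {α = α} m occ = subst (λ v → IsMin v α) (sym (proj₁ occ)) m
  IsMin-drop (suc x)         m occ = IsMin-drop x (IsMin-tail m occ) (Occurrence-tail occ)

  IsMin-eventually-periodic : ∀ {u α s} → IsMin u α → Occurrence α u s →
                              ∃₂ λ i q → Periodic (suc q) (drop i α)
  IsMin-eventually-periodic {α = α} {s} m occ with repeats s
  ... | i , q , eq = i , q , periodic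
    (≈ₛ.trans (cong-app (sym (drop-+ i (suc q) α)))
              (IsMin-unique (IsMin-drop (i + suc q) m occ)
                            (subst (λ v → IsMin v (drop i α)) eq (IsMin-drop i m occ))))

open Strings
open Minima

lemma19 : ∀ {n σ} (G : Graph n σ) → let open Graph G in
  (min : Fin n → Str σ) → (∀ v → IsMin v (min v)) →
  (u : Fin n) (s : ℕ → Fin n) → Occurrence (min u) u s →
  let C1 = ∃ λ i₀ → (∀ i → i < i₀ → ¬ τ≡2 (min (s i))) × (∀ i → i₀ ≤ i → τ≡2 (min (s i)))
      C2 = (∀ i → ¬ τ≡2 (min (s i)))
           × (∀ N → ∃ λ i → N ≤ i × τ≡1 (min (s i)))
           × (∀ N → ∃ λ i → N ≤ i × τ≡3 (min (s i)))
  in (C1 ⊎ C2) × ¬ (C1 × C2)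
lemma19 G min isMin u s occ
  with i , q , per ← IsMin-eventually-periodic G (isMin u) occ =
  map (Settles-resp suffix-is-min) (Oscillates-resp suffix-is-min)
      (eventually-periodic-dichotomy (min u) i q per) ,
  ¬Settles×Oscillates
  where
  suffix-is-min : ∀ x → drop x (min u) ≈ₛ min (s x)
  suffix-is-min x = IsMin-unique G (IsMin-drop G x (isMin u) occ) (isMin (s x))
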